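{- Let $\mathcal F=(W,\to)$ be a weakly transitive frame, and let $(X_{\mathcal F},\tau_{\mathcal F})$ be the following space: $X_{\mathcal F}=(W^{\mathrm r}\times\mathbb N)\cup(W^{\mathrm i}\times\{\omega\})$ where $W^{\mathrm r}$, $W^{\mathrm i}$ are the sets of reflexive and irreflexive points of $W$, and $U\subseteq X_{\mathcal F}$ is open iff for every $(w,\alpha)\in U$: (i) there is $n\in\mathbb N$ such that every $(v,\beta)\in X_{\mathcal F}$ with $v\leftrightarrow w$ and $\beta\ge n$ lies in $U$, and (ii) every $(v,\beta)\in X_{\mathcal F}$ with $w\Rightarrow v$ lies in $U$. Then: (1) if $\mathcal F$ is a $\mathsf{wK4T_0}$ frame, then $X_{\mathcal F}$ is a $T_0$ space; (2) if $\mathcal F$ is a $\mathsf{K4}$ frame, then $X_{\mathcal F}$ is a $T_D$ space.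
   Context: Weakly transitive: $w\to s\to t$ implies $w=t$ or $w\to t$. $v\leftrightarrow w$ means $v\to w\to v$; $w\Rightarrow v$ means $w\to v$ and not $v\to w$. (These open sets form a topology.) A $\mathsf{wK4T_0}$ frame is a weakly transitive frame in which $w\to v\to w$ implies $w\to w$ or $v\to v$; a $\mathsf{K4}$ frame is a transitive frame. A space is $T_0$ if for distinct points $x,y$, $x\notin\mathrm{cl}\{y\}$ or $y\notin\mathrm{cl}\{x\}$; it is $T_D$ if every point $x$ has an open set $U$ with $\{x\}=U\cap\mathrm{cl}\{x\}$. -}

module Defs where

open import Level using (Level; 0ℓ) renaming (suc to lsuc)
open import Data.Nat using (ℕ; _≤_)
open import Data.Product using (Σ; _×_; ∃)
open import Data.Sum using (_⊎_)
open import Data.Unit using (⊤)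
open import Relation.Nullary using (¬_)
open import Relation.Binary.PropositionalEquality using (_≡_)

data ℕω : Set where
  fin : ℕ → ℕω
  ω   : ℕω

_≥ω_ : ℕω → ℕ → Set
fin m ≥ω n = n ≤ m
ω     ≥ω n = ⊤

module Frame {W : Set} (_⟶_ : W → W → Set) where

  WeaklyTransitive : Set
  WeaklyTransitive = ∀ {w s t} → w ⟶ s → s ⟶ t → (w ≡ t) ⊎ (w ⟶ t)

  Transitive : Set
  Transitive = ∀ {w s t} → w ⟶ s → s ⟶ t → w ⟶ t

  IsWK4T0 : Set
  IsWK4T0 = WeaklyTransitive × (∀ {w v} → w ⟶ v → v ⟶ w → (w ⟶ w) ⊎ (v ⟶ v))

  IsK4 : Set
  IsK4 = Transitive

  _⟷_ : W → W → Set
  v ⟷ w = (v ⟶ w) × (w ⟶ v)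

  _⇒_ : W → W → Set
  w ⇒ v = (w ⟶ v) × ¬ (v ⟶ w)

  InX : W → ℕω → Set
  InX w (fin _) = w ⟶ w
  InX w ω       = ¬ (w ⟶ w)

  record Pt : Set where
    constructor pt
    field
      world : W
      index : ℕω
      inX   : InX world index
  open Pt public

  _≈_ : Pt → Pt → Set
  x ≈ y = (world x ≡ world y) × (index x ≡ index y)

  Subset : Set₁
  Subset = W → ℕω → Set

  _∈_ : Pt → Subset → Set
  x ∈ U = U (world x) (index x)

  IsOpen : Subset → Set
  IsOpen U = (x : Pt) → x ∈ U →
      (Σ ℕ λ n → (y : Pt) → world y ⟷ world x → index y ≥ω n → y ∈ U)
    × ((y : Pt) → world x ⇒ world y → y ∈ U)

  _∈cl_ : Pt → Pt → Set₁
  x ∈cl y = (U : Subset) → IsOpen U → x ∈ U → y ∈ U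

  IsT0 : Set₁
  IsT0 = (x y : Pt) → ¬ (x ≈ y) → ¬ (x ∈cl y) ⊎ ¬ (y ∈cl x)

  IsTD : Set₁
  IsTD = (x : Pt) → Σ Subset λ U → IsOpen U × x ∈ U
           × ((z : Pt) → z ∈ U → z ∈cl x → z ≈ x)

{-# OPTIONS --safe #-}
module Submission where

-- Every point (w , α) has the basic open neighbourhoods
--   nbhd w m n = {w} × [m, ω] ∪ {v | v ⟷ w} × [n, ω] ∪ {v | w ⇒ v},
-- open by weak transitivity.  Testing closure against them shows that
-- x ∈ cl{y} forces either the same world with index x ≤ index y, or
-- world x ⇒ world y, or world x ⟷ world y with index y = ω.  For T₀ the
-- specialisation preorder is then antisymmetric, the only remaining case
-- (two ω-points in one cluster) being excluded by the wK4T₀ condition;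
-- for T_D the neighbourhood nbhd w a a of (w , fin a), resp. nbhd w 0 0 of
-- (w , ω), meets its closure in that point alone, since in a K4 frame the
-- ⟷-with-ω case cannot arise.

open import Defs
open import Level using (0ℓ)
import Level
open import Axiom.ExcludedMiddle using (ExcludedMiddle)
open import Data.Product using (_×_; _,_; proj₁; proj₂)
open import Data.Sum using (_⊎_; inj₁; inj₂)
open import Data.Empty using (⊥-elim)
open import Data.Unit using (tt)
open import Data.Nat using (ℕ; suc; _≤_; z≤n; _⊔_)
open import Data.Nat.Properties using (≤-trans; ≤-antisym; ≤-refl; m≤m⊔n; m≤n⊔m; 1+n≰n)
open import Relation.Nullary using (¬_; yes; no)
open import Relation.Binary.PropositionalEquality using (_≡_; _≢_; refl; sym; cong; ≢-sym)

≥ω-zero : ∀ β → β ≥ω 0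
≥ω-zero (fin _) = z≤n
≥ω-zero ω       = tt

≥ω-weaken : ∀ {β m n} → m ≤ n → β ≥ω n → β ≥ω m
≥ω-weaken {fin _} m≤n n≤k = ≤-trans m≤n n≤k
≥ω-weaken {ω}     _   _   = tt

threshold : ℕω → ℕ
threshold (fin a) = a
threshold ω       = 0

≥ω-threshold : ∀ α → α ≥ω threshold α
≥ω-threshold (fin a) = ≤-refl
≥ω-threshold ω       = tt

module _ {W : Set} (_⟶_ : W → W → Set) where
  open Frame _⟶_

  ⇒-irrefl : ∀ {w} → ¬ (w ⇒ w)
  ⇒-irrefl (ww , ¬ww) = ¬ww ww

  ω-irrefl : (x : Pt) → index x ≡ ω → ¬ (world x ⟶ world x)
  ω-irrefl (pt _ ω irr) refl = irr

  nbhd : W → ℕ → ℕ → Subset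
  nbhd w m n v β = ((v ≡ w) × (β ≥ω m)) ⊎ ((v ⟷ w) × (β ≥ω n)) ⊎ (w ⇒ v)

  nbhd-self : ∀ {w m β} → nbhd w m m w β → β ≥ω m
  nbhd-self (inj₁ (_ , β≥m))        = β≥m
  nbhd-self (inj₂ (inj₁ (_ , β≥m))) = β≥m
  nbhd-self (inj₂ (inj₂ w⇒w))       = ⊥-elim (⇒-irrefl w⇒w)

  module _ (wt : WeaklyTransitive) where

    ⟷-weak-trans : ∀ {u v w} → u ⟷ v → v ⟷ w → (u ≡ w) ⊎ (u ⟷ w)
    ⟷-weak-trans (uv , vu) (vw , wv) with wt uv vw | wt wv vu
    ... | inj₁ u≡w | _         = inj₁ u≡w
    ... | inj₂ _   | inj₁ w≡u  = inj₁ (sym w≡u)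
    ... | inj₂ uw  | inj₂ wu   = inj₂ (uw , wu)

    ⇒-⟶-trans : ∀ {w v u} → w ⇒ v → v ⟶ u → w ⇒ u
    ⇒-⟶-trans {w} {v} (wv , ¬vw) vu with wt wv vu
    ... | inj₁ refl = ⊥-elim (¬vw vu)
    ... | inj₂ wu   = wu , λ uw → ¬v≡w⊎v⟶w (wt vu uw)
      where
      ¬v≡w⊎v⟶w : ¬ ((v ≡ w) ⊎ (v ⟶ w))
      ¬v≡w⊎v⟶w (inj₁ refl) = ¬vw wv
      ¬v≡w⊎v⟶w (inj₂ vw)   = ¬vw vw

    ⟶-⇒-trans : ∀ {w v u} → w ⟶ v → v ⇒ u → w ⇒ u
    ⟶-⇒-trans {v = v} {u} wv (vu , ¬uv) with wt wv vu
    ... | inj₁ refl = ⊥-elim (¬uv wv)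
    ... | inj₂ wu   = wu , λ uw → ¬u≡v⊎u⟶v (wt uw wv)
      where
      ¬u≡v⊎u⟶v : ¬ ((u ≡ v) ⊎ (u ⟶ v))
      ¬u≡v⊎u⟶v (inj₁ refl) = ¬uv vu
      ¬u≡v⊎u⟶v (inj₂ uv)   = ¬uv uv

    nbhd-open : ∀ w m n → IsOpen (nbhd w m n)
    nbhd-open w m n (pt _ _ _) (inj₁ (refl , _)) =
      (n , λ y y⟷w β≥n → inj₂ (inj₁ (y⟷w , β≥n))) , λ y w⇒y → inj₂ (inj₂ w⇒y)
    nbhd-open w m n (pt v _ _) (inj₂ (inj₁ (v⟷w , _))) =
      (m ⊔ n , cluster) , λ y v⇒y → inj₂ (inj₂ (⟶-⇒-trans (proj₂ v⟷w) v⇒y))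
      where
      cluster : (y : Pt) → world y ⟷ v → index y ≥ω (m ⊔ n) → y ∈ nbhd w m n
      cluster y y⟷v β≥m⊔n with ⟷-weak-trans y⟷v v⟷w
      ... | inj₁ y≡w  = inj₁ (y≡w , ≥ω-weaken (m≤m⊔n m n) β≥m⊔n)
      ... | inj₂ y⟷w = inj₂ (inj₁ (y⟷w , ≥ω-weaken (m≤n⊔m m n) β≥m⊔n))
    nbhd-open w m n (pt v _ _) (inj₂ (inj₂ w⇒v)) =
      (0 , λ y y⟷v _ → inj₂ (inj₂ (⇒-⟶-trans w⇒v (proj₂ y⟷v)))) ,
      λ y v⇒y → inj₂ (inj₂ (⇒-⟶-trans w⇒v (proj₁ v⇒y)))

    ∈cl⇒∈nbhd : ∀ x y {m} n → x ∈cl y → index x ≥ω m → y ∈ nbhd (world x) m n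
    ∈cl⇒∈nbhd x y {m} n x∈cly α≥m =
      x∈cly (nbhd (world x) m n) (nbhd-open (world x) m n) (inj₁ (refl , α≥m))

    ∈cl-fin : ∀ {w a b} p q → pt w (fin a) p ∈cl pt w (fin b) q → a ≤ b
    ∈cl-fin p q x∈cly = nbhd-self (∈cl⇒∈nbhd (pt _ _ p) (pt _ _ q) _ x∈cly ≤-refl)

    nbhd∩cl-same-world : ∀ {w α β} p q → pt w β q ∈ nbhd w (threshold α) (threshold α) →
                         pt w β q ∈cl pt w α p → β ≡ α
    nbhd∩cl-same-world {α = fin _} {fin _} p q z∈U z∈clx =
      cong fin (≤-antisym (∈cl-fin q p z∈clx) (nbhd-self z∈U))
    nbhd∩cl-same-world {α = fin _} {ω}     p q _ _ = ⊥-elim (q p)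
    nbhd∩cl-same-world {α = ω}     {fin _} p q _ _ = ⊥-elim (p q)
    nbhd∩cl-same-world {α = ω}     {ω}     _ _ _ _ = refl

    -- The neighbourhood nbhd (world x) 0 (suc b) separates x from a point
    -- (v , fin b) of its cluster.
    ∈cl-distinct : ∀ x y → x ∈cl y → world x ≢ world y →
                   (world x ⇒ world y) ⊎ ((world x ⟷ world y) × index y ≡ ω)
    ∈cl-distinct x@(pt _ α _) y@(pt _ (fin b) _) x∈cly w≢v
      with ∈cl⇒∈nbhd x y (suc b) x∈cly (≥ω-zero α)
    ... | inj₁ (v≡w , _)              = ⊥-elim (w≢v (sym v≡w))
    ... | inj₂ (inj₁ (_ , b+1≤b))     = ⊥-elim (1+n≰n b+1≤b)
    ... | inj₂ (inj₂ w⇒v)             = inj₁ w⇒v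
    ∈cl-distinct x@(pt _ α _) y@(pt _ ω _) x∈cly w≢v
      with ∈cl⇒∈nbhd x y 0 x∈cly (≥ω-zero α)
    ... | inj₁ (v≡w , _)              = ⊥-elim (w≢v (sym v≡w))
    ... | inj₂ (inj₁ ((vw , wv) , _)) = inj₂ ((wv , vw) , refl)
    ... | inj₂ (inj₂ w⇒v)             = inj₁ w⇒v

    ∈cl-distinct-⟶ : ∀ x y → x ∈cl y → world x ≢ world y → world x ⟶ world y
    ∈cl-distinct-⟶ x y x∈cly w≢v with ∈cl-distinct x y x∈cly w≢v
    ... | inj₁ (wv , _)       = wv
    ... | inj₂ ((wv , _) , _) = wv

    ∈cl-distinct-K4 : IsK4 → ∀ x y → x ∈cl y → world x ≢ world y → world x ⇒ world y
    ∈cl-distinct-K4 k4 x y x∈cly w≢v with ∈cl-distinct x y x∈cly w≢v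
    ... | inj₁ w⇒v                  = w⇒v
    ... | inj₂ ((wv , vw) , index≡ω) = ⊥-elim (ω-irrefl y index≡ω (k4 vw wv))

    module _ (em : ExcludedMiddle 0ℓ) where

      ∈cl-antisym : IsWK4T0 → ∀ x y → x ∈cl y → y ∈cl x → x ≈ y
      ∈cl-antisym _ (pt w α p) (pt v β q) x∈cly y∈clx with em {w ≡ v}
      ∈cl-antisym _ (pt w (fin a) p) (pt w (fin b) q) x∈cly y∈clx | yes refl =
        refl , cong fin (≤-antisym (∈cl-fin p q x∈cly) (∈cl-fin q p y∈clx))
      ∈cl-antisym _ (pt w (fin _) p) (pt w ω q) _ _ | yes refl = ⊥-elim (q p)
      ∈cl-antisym _ (pt w ω p) (pt w (fin _) q) _ _ | yes refl = ⊥-elim (p q)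
      ∈cl-antisym _ (pt w ω p) (pt w ω q) _ _       | yes refl = refl , refl
      ∈cl-antisym (_ , cluster-reflexive) x y x∈cly y∈clx | no w≢v
        with ∈cl-distinct x y x∈cly w≢v | ∈cl-distinct y x y∈clx (≢-sym w≢v)
      ... | inj₁ (_ , ¬vw) | _ = ⊥-elim (¬vw (∈cl-distinct-⟶ y x y∈clx (≢-sym w≢v)))
      ... | inj₂ _ | inj₁ (_ , ¬wv) = ⊥-elim (¬wv (∈cl-distinct-⟶ x y x∈cly w≢v))
      ... | inj₂ ((wv , vw) , β≡ω) | inj₂ (_ , α≡ω) with cluster-reflexive wv vw
      ...   | inj₁ ww = ⊥-elim (ω-irrefl x α≡ω ww)
      ...   | inj₂ vv = ⊥-elim (ω-irrefl y β≡ω vv)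

      K4⇒TD : IsK4 → IsTD
      K4⇒TD k4 x@(pt w α p) =
        nbhd w (threshold α) (threshold α) , nbhd-open w _ _ ,
        inj₁ (refl , ≥ω-threshold α) , only-x
        where
        only-x : (z : Pt) → z ∈ nbhd w (threshold α) (threshold α) → z ∈cl x → z ≈ x
        only-x (pt v β q) z∈U z∈clx with em {v ≡ w}
        ... | yes refl = refl , nbhd∩cl-same-world p q z∈U z∈clx
        ... | no v≢w = ⊥-elim (w⟶v∉nbhd z∈U)
          where
          ¬w⟶v : ¬ (w ⟶ v)
          ¬w⟶v = proj₂ (∈cl-distinct-K4 k4 (pt v β q) x z∈clx v≢w)
          w⟶v∉nbhd : ¬ nbhd w (threshold α) (threshold α) v β
          w⟶v∉nbhd (inj₁ (v≡w , _))             = v≢w v≡w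
          w⟶v∉nbhd (inj₂ (inj₁ ((_ , wv) , _))) = ¬w⟶v wv
          w⟶v∉nbhd (inj₂ (inj₂ (wv , _)))       = ¬w⟶v wv

  antisymmetric⇒T0 : ExcludedMiddle (Level.suc 0ℓ) →
                     (∀ x y → x ∈cl y → y ∈cl x → x ≈ y) → IsT0
  antisymmetric⇒T0 em₁ antisym x y x≉y with em₁ {x ∈cl y}
  ... | yes x∈cly = inj₂ λ y∈clx → x≉y (antisym x y x∈cly y∈clx)
  ... | no x∉cly  = inj₁ x∉cly

mainTheorem19 : ExcludedMiddle 0ℓ → ExcludedMiddle (Level.suc 0ℓ) →
    (W : Set) (_⟶_ : W → W → Set) → Frame.WeaklyTransitive _⟶_ →
      (Frame.IsWK4T0 _⟶_ → Frame.IsT0 _⟶_)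
    × (Frame.IsK4 _⟶_ → Frame.IsTD _⟶_)
mainTheorem19 em em₁ _ _⟶_ wt =
  (λ wK4T0 → antisymmetric⇒T0 _⟶_ em₁ (∈cl-antisym _⟶_ wt em wK4T0)) ,
  K4⇒TD _⟶_ wt em
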